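{- Let $\lambda\geq 2$ and $n$ be positive integers and let $M=(m_1,m_2,\ldots,m_t)$ be a list of integers satisfying (A1) $2\leq m_1,m_2,\ldots,m_t\leq n$; (A2) $m_1+\cdots+m_t=\lambda\binom n2$ when $\lambda(n-1)$ is even; and (A3) $m_1+\cdots+m_t=\lambda\binom n2-\frac n2$ when $\lambda(n-1)$ is odd. If either $\nu_2(M)<n$, or $\lambda$ is even and the two largest entries of $M$ (counted with multiplicity) are equal, then $M$ is $(\lambda,n)$-admissible.
   Context: $\nu_m(M)$ denotes the number of entries of $M$ equal to $m$. A list $M=(m_1,\ldots,m_t)$ is $(\lambda,n)$-admissible if (A1) $2\leq m_i\leq n$ for all $i$; (A2) $\sum m_i=\lambda\binom n2$ when $\lambda(n-1)$ is even; (A3) $\sum m_i=\lambda\binom n2-\frac n2$ when $\lambda(n-1)$ is odd; (A4) $\max_i m_i+t-2\leq\frac\lambda2\binom n2$ when $\lambda$ is even; (A5) $\sum_{i:\,m_i=2}m_i\leq(\lambda-1)\binom n2$ when $\lambda$ is odd. -}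

module Defs where

open import Data.Nat using (ℕ; zero; suc; _+_; _*_; _∸_; _≤_; _<_; _⊔_; _/_)
open import Data.Nat.Combinatorics using (_C_)
open import Data.Nat.Properties using (_≟_)
open import Data.Nat.Divisibility using (_∣_)
open import Relation.Nullary using (¬_)
open import Data.List using (List; length; foldr; filter)
open import Data.Nat.ListAction using (sum)
open import Data.List.Relation.Unary.All using (All)
open import Relation.Binary.PropositionalEquality using (_≡_)
open import Data.Product using (_×_)

Even : ℕ → Set
Even k = 2 ∣ k

Odd : ℕ → Set
Odd k = ¬ (2 ∣ k)

ν : ℕ → List ℕ → ℕ
ν m M = length (filter (_≟ m) M)

-- largest entry of M (0 for the empty list; only used for nonempty lists)
maxL : List ℕ → ℕ
maxL = foldr _⊔_ 0

sum2 : List ℕ → ℕ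
sum2 M = sum (filter (_≟ 2) M)

A1 : ℕ → List ℕ → Set
A1 n M = All (λ m → 2 ≤ m × m ≤ n) M

A2 : ℕ → ℕ → List ℕ → Set
A2 l n M = Even (l * (n ∸ 1)) → sum M ≡ l * (n C 2)

-- (A3): sum M = λ C(n,2) - n/2 when λ(n-1) is odd
-- (stated as sum M + n/2 = λ C(n,2); n is even in this case, so n/2 is exact
--  and λ C(n,2) ≥ n/2, hence this is equivalent to the subtraction form)
A3 : ℕ → ℕ → List ℕ → Set
A3 l n M = Odd (l * (n ∸ 1)) → sum M + n / 2 ≡ l * (n C 2)

-- (A4): max M + t - 2 ≤ (λ/2) C(n,2) when λ is even
-- (multiplied by 2 and with the -2 moved to the right to avoid truncated subtraction)
A4 : ℕ → ℕ → List ℕ → Set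
A4 l n M = Even l → 2 * (maxL M + length M) ≤ l * (n C 2) + 4

A5 : ℕ → ℕ → List ℕ → Set
A5 l n M = Odd l → sum2 M ≤ (l ∸ 1) * (n C 2)

Admissible : ℕ → ℕ → List ℕ → Set
Admissible l n M = A1 n M × A2 l n M × A3 l n M × A4 l n M × A5 l n M

module Submission where

-- Proof idea.  (A1)-(A3) are hypotheses, so only (A4) and (A5) need proof.
-- Write t = length M, S = λ·C(n,2), a = ν₂(M), m = max M.
--
-- (A5), λ odd: then λ ≥ 3 and we are in the case a < n, so the entries
-- equal to 2 sum to 2a ≤ 2(n-1) ≤ 2·C(n,2) ≤ (λ-1)·C(n,2).
--
-- (A4), λ even: then λ(n-1) is even and (A2) gives sum M = S.
--  * If the largest entry occurs twice, those two copies together with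
--    2 for every other entry bound the sum: 2t + 2m ≤ S + 4.
--  * If a < n, every entry y contributes y + [y = 2] ≥ 3, and the largest
--    entry contributes at least m; hence 3t + m ≤ S + a + 3.  Eliminating
--    t against 2m + 2t ≤ S + 4 and rounding (3x ≤ 3k+2 ⇒ x ≤ k) reduces
--    the claim to 4m + 2a ≤ S + 8, which follows from 6n ≤ S + 10 — true
--    except for λ = 2, n ∈ {3,4}.  There S = 3k with 2n ≤ k + 4, and a
--    sharper rounding argument in the case m = n finishes the proof.

open import Defs
open import Data.Nat using (ℕ; zero; suc; _+_; _*_; _∸_; _⊔_; _≤_; _<_; z≤n; s≤s; s≤s⁻¹)
open import Data.Nat.Properties
open import Data.Nat.Combinatorics using (_C_; nCk+nC[k+1]≡[n+1]C[k+1]; nC1≡n)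
open import Data.Nat.Divisibility using (∣m⇒∣m*n; ∣-refl)
open import Data.Nat.ListAction using (sum)
open import Data.Nat.Tactic.RingSolver using (solve-∀)
open import Data.List using (List; []; _∷_; length)
open import Data.List.Properties using (filter-accept; filter-reject)
open import Data.List.Relation.Unary.All as All using (All; []; _∷_)
open import Data.Product using (_×_; _,_; proj₁; proj₂; ∃-syntax)
open import Data.Sum using (_⊎_; inj₁; inj₂)
open import Data.Empty using (⊥-elim)
open import Relation.Nullary using (yes; no; ¬_)
open import Relation.Binary.PropositionalEquality using (_≡_; refl; sym; trans; cong; subst)

open ≤-Reasoning

ν-here : ∀ x L → ν x (x ∷ L) ≡ suc (ν x L)
ν-here x L = cong length (filter-accept (_≟ x) {xs = L} refl)

ν-there : ∀ x y L → ¬ (y ≡ x) → ν x (y ∷ L) ≡ ν x L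
ν-there x y L y≢x = cong length (filter-reject (_≟ x) y≢x)

ν-cons : ∀ x y L → ν x L ≤ ν x (y ∷ L)
ν-cons x y L with y ≟ x
... | yes refl rewrite ν-here x L = n≤1+n _
... | no y≢x rewrite ν-there x y L y≢x = ≤-refl

sum2≡2ν₂ : ∀ M → sum2 M ≡ 2 * ν 2 M
sum2≡2ν₂ [] = refl
sum2≡2ν₂ (y ∷ L) with y ≟ 2
... | yes refl = begin-equality
  sum2 (2 ∷ L)       ≡⟨ cong sum (filter-accept (_≟ 2) {xs = L} refl) ⟩
  2 + sum2 L         ≡⟨ cong (2 +_) (sum2≡2ν₂ L) ⟩
  2 + 2 * ν 2 L      ≡⟨ *-suc 2 (ν 2 L) ⟨
  2 * suc (ν 2 L)    ≡⟨ cong (2 *_) (ν-here 2 L) ⟨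
  2 * ν 2 (2 ∷ L)    ∎
... | no y≢2 = begin-equality
  sum2 (y ∷ L)       ≡⟨ cong sum (filter-reject (_≟ 2) y≢2) ⟩
  sum2 L             ≡⟨ sum2≡2ν₂ L ⟩
  2 * ν 2 L          ≡⟨ cong (2 *_) (ν-there 2 y L y≢2) ⟨
  2 * ν 2 (y ∷ L)    ∎

maxL≤ : ∀ {n} M → All (_≤ n) M → maxL M ≤ n
maxL≤ [] [] = z≤n
maxL≤ (y ∷ L) (y≤n ∷ L≤n) = ⊔-lub y≤n (maxL≤ L L≤n)

twoPerEntry : ∀ M → All (2 ≤_) M → 2 * length M ≤ sum M
twoPerEntry [] [] = z≤n
twoPerEntry (y ∷ L) (2≤y ∷ L≥2) = begin
  2 * suc (length L)  ≡⟨ *-suc 2 (length L) ⟩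
  2 + 2 * length L    ≤⟨ +-mono-≤ 2≤y (twoPerEntry L L≥2) ⟩
  y + sum L           ∎

-- If x occurs at least k times, those k copies contribute k·x and every
-- other entry at least 2.  (Used with k = 2 and x the largest entry.)
copiesBound : ∀ x k M → All (2 ≤_) M → k ≤ ν x M →
              2 * length M + k * x ≤ sum M + 2 * k
copiesBound x zero M M≥2 _ = +-monoˡ-≤ 0 (twoPerEntry M M≥2)
copiesBound x (suc k) (y ∷ L) (2≤y ∷ L≥2) k<ν with y ≟ x
... | yes refl = begin
  2 * suc t + suc k * y    ≡⟨ regroup t k y ⟩
  (2 + y) + (2 * t + k * y) ≤⟨ +-monoʳ-≤ (2 + y) (copiesBound y k L L≥2 (s≤s⁻¹ k<ν′)) ⟩
  (2 + y) + (sum L + 2 * k) ≡⟨ regroup′ (sum L) k y ⟩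
  y + sum L + 2 * suc k    ∎
  where
  t = length L
  k<ν′ = subst (suc k ≤_) (ν-here y L) k<ν
  regroup : ∀ t k y → 2 * suc t + suc k * y ≡ (2 + y) + (2 * t + k * y)
  regroup = solve-∀
  regroup′ : ∀ s k y → (2 + y) + (s + 2 * k) ≡ y + s + 2 * suc k
  regroup′ = solve-∀
... | no y≢x = begin
  2 * suc t + suc k * x       ≡⟨ regroup t (suc k * x) ⟩
  2 + (2 * t + suc k * x)     ≤⟨ +-mono-≤ 2≤y (copiesBound x (suc k) L L≥2 k<ν′) ⟩
  y + (sum L + 2 * suc k)     ≡⟨ +-assoc y (sum L) (2 * suc k) ⟨
  y + sum L + 2 * suc k       ∎
  where
  t = length L
  k<ν′ = subst (suc k ≤_) (ν-there x y L y≢x) k<ν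
  regroup : ∀ t c → 2 * suc t + c ≡ 2 + (2 * t + c)
  regroup = solve-∀

-- The weight of an entry, y + [y = 2], is at least 3.
entryWeight : ∀ y L → 2 ≤ y → 3 + ν 2 L ≤ y + ν 2 (y ∷ L)
entryWeight y L 2≤y with y ≟ 2
... | yes refl rewrite ν-here 2 L = ≤-reflexive (+-suc 2 (ν 2 L))
... | no y≢2 rewrite ν-there 2 y L y≢2 =
  +-monoˡ-≤ (ν 2 L) (≤∧≢⇒< 2≤y (λ 2≡y → y≢2 (sym 2≡y)))

threePerEntry : ∀ M → All (2 ≤_) M → 3 * length M ≤ sum M + ν 2 M
threePerEntry [] [] = z≤n
threePerEntry (y ∷ L) (2≤y ∷ L≥2) = begin
  3 * suc t              ≡⟨ *-suc 3 t ⟩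
  3 + 3 * t              ≤⟨ +-monoʳ-≤ 3 (threePerEntry L L≥2) ⟩
  3 + (sum L + ν 2 L)    ≡⟨ regroup (sum L) (ν 2 L) ⟩
  sum L + (3 + ν 2 L)    ≤⟨ +-monoʳ-≤ (sum L) (entryWeight y L 2≤y) ⟩
  sum L + (y + ν 2 (y ∷ L)) ≡⟨ regroup′ (sum L) y (ν 2 (y ∷ L)) ⟩
  y + sum L + ν 2 (y ∷ L) ∎
  where
  t = length L
  regroup : ∀ s v → 3 + (s + v) ≡ s + (3 + v)
  regroup = solve-∀
  regroup′ : ∀ s y w → s + (y + w) ≡ y + s + w
  regroup′ = solve-∀

-- Refinement: the largest entry m contributes at least m (instead of 3),
-- so 3t + m ≤ sum M + ν₂(M) + 3.
maxEntryBound : ∀ M → All (2 ≤_) M → 3 * length M + maxL M ≤ sum M + ν 2 M + 3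
maxEntryBound [] [] = z≤n
maxEntryBound (y ∷ L) (2≤y ∷ L≥2) with ≤-total (maxL L) y
... | inj₁ maxL≤y = begin
  3 * suc t + (y ⊔ maxL L)    ≡⟨ cong (3 * suc t +_) (m≥n⇒m⊔n≡m maxL≤y) ⟩
  3 * suc t + y               ≡⟨ regroup t y ⟩
  3 * t + (y + 3)             ≤⟨ +-monoˡ-≤ (y + 3) rest ⟩
  sum L + ν 2 (y ∷ L) + (y + 3) ≡⟨ regroup′ (sum L) (ν 2 (y ∷ L)) y ⟩
  y + sum L + ν 2 (y ∷ L) + 3 ∎
  where
  t = length L
  rest = ≤-trans (threePerEntry L L≥2) (+-monoʳ-≤ (sum L) (ν-cons 2 y L))
  regroup : ∀ t y → 3 * suc t + y ≡ 3 * t + (y + 3)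
  regroup = solve-∀
  regroup′ : ∀ s w y → s + w + (y + 3) ≡ y + s + w + 3
  regroup′ = solve-∀
... | inj₂ y≤maxL = begin
  3 * suc t + (y ⊔ maxL L)    ≡⟨ cong (3 * suc t +_) (m≤n⇒m⊔n≡n y≤maxL) ⟩
  3 * suc t + maxL L          ≡⟨ regroup t (maxL L) ⟩
  3 + (3 * t + maxL L)        ≤⟨ +-monoʳ-≤ 3 (maxEntryBound L L≥2) ⟩
  3 + (sum L + ν 2 L + 3)     ≡⟨ regroup′ (sum L) (ν 2 L) ⟩
  (3 + ν 2 L) + (sum L + 3)   ≤⟨ +-monoˡ-≤ (sum L + 3) (entryWeight y L 2≤y) ⟩
  (y + ν 2 (y ∷ L)) + (sum L + 3) ≡⟨ regroup″ y (ν 2 (y ∷ L)) (sum L) ⟩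
  y + sum L + ν 2 (y ∷ L) + 3 ∎
  where
  t = length L
  regroup : ∀ t m → 3 * suc t + m ≡ 3 + (3 * t + m)
  regroup = solve-∀
  regroup′ : ∀ s v → 3 + (s + v + 3) ≡ (3 + v) + (s + 3)
  regroup′ = solve-∀
  regroup″ : ∀ y w s → (y + w) + (s + 3) ≡ y + s + w + 3
  regroup″ = solve-∀

third≤ : ∀ x k → 3 * x ≤ 3 * k + 2 → x ≤ k
third≤ x k h = s≤s⁻¹ (*-cancelˡ-< 3 x (suc k) (begin-strict
  3 * x          ≤⟨ h ⟩
  3 * k + 2      <⟨ n<1+n _ ⟩
  suc (3 * k + 2) ≡⟨ regroup k ⟩
  3 * suc k      ∎))
  where
  regroup : ∀ k → suc (3 * k + 2) ≡ 3 * suc k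
  regroup = solve-∀

eliminateLength : ∀ m t S a → 3 * t + m ≤ S + a + 3 → 4 * m + 2 * a ≤ S + 8 →
                  2 * m + 2 * t ≤ S + 4
eliminateLength m t S a h side = third≤ (2 * m + 2 * t) (S + 4) (begin
  3 * (2 * m + 2 * t)         ≡⟨ regroup m t ⟩
  2 * (3 * t + m) + 4 * m     ≤⟨ +-monoˡ-≤ (4 * m) (*-monoʳ-≤ 2 h) ⟩
  2 * (S + a + 3) + 4 * m     ≡⟨ regroup′ S a m ⟩
  2 * S + 6 + (4 * m + 2 * a) ≤⟨ +-monoʳ-≤ (2 * S + 6) side ⟩
  2 * S + 6 + (S + 8)         ≡⟨ regroup″ S ⟩
  3 * (S + 4) + 2             ∎)
  where
  regroup : ∀ m t → 3 * (2 * m + 2 * t) ≡ 2 * (3 * t + m) + 4 * m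
  regroup = solve-∀
  regroup′ : ∀ S a m → 2 * (S + a + 3) + 4 * m ≡ 2 * S + 6 + (4 * m + 2 * a)
  regroup′ = solve-∀
  regroup″ : ∀ S → 2 * S + 6 + (S + 8) ≡ 3 * (S + 4) + 2
  regroup″ = solve-∀

roomyBound : ∀ n S m a t → 6 * n ≤ S + 10 → m ≤ n → a < n →
             3 * t + m ≤ S + a + 3 → 2 * m + 2 * t ≤ S + 4
roomyBound n S m a t room m≤n a<n h = eliminateLength m t S a h (+-cancelʳ-≤ 2 _ _ (begin
  4 * m + 2 * a + 2    ≡⟨ regroup m a ⟩
  4 * m + 2 * suc a    ≤⟨ +-mono-≤ (*-monoʳ-≤ 4 m≤n) (*-monoʳ-≤ 2 a<n) ⟩
  4 * n + 2 * n        ≡⟨ *-distribʳ-+ n 4 2 ⟨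
  6 * n                ≤⟨ room ⟩
  S + 10               ≡⟨ +-assoc S 8 2 ⟨
  S + 8 + 2            ∎))
  where
  regroup : ∀ m a → 4 * m + 2 * a + 2 ≡ 4 * m + 2 * suc a
  regroup = solve-∀

-- The tight case S = 3k with 2n ≤ k + 4.  For m < n the side condition still
-- holds; for m = n rounding bounds t by k directly.
tightBound : ∀ n k m a t → 2 * n ≤ k + 4 → m ≤ n → a < n →
             3 * t + m ≤ 3 * k + a + 3 → 2 * m + 2 * t ≤ 3 * k + 4
tightBound n k m a t tight m≤n a<n h with m≤n⇒m<n∨m≡n m≤n
... | inj₁ m<n = eliminateLength m t (3 * k) a h (+-cancelʳ-≤ 6 _ _ (begin
  4 * m + 2 * a + 6        ≡⟨ regroup m a ⟩
  4 * suc m + 2 * suc a    ≤⟨ +-mono-≤ (*-monoʳ-≤ 4 m<n) (*-monoʳ-≤ 2 a<n) ⟩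
  4 * n + 2 * n            ≡⟨ regroup′ n ⟩
  3 * (2 * n)              ≤⟨ *-monoʳ-≤ 3 tight ⟩
  3 * (k + 4)              ≡⟨ regroup″ k ⟩
  3 * k + 8 + 4            ≤⟨ +-monoʳ-≤ (3 * k + 8) (m≤m+n 4 2) ⟩
  3 * k + 8 + 6            ∎))
  where
  regroup : ∀ m a → 4 * m + 2 * a + 6 ≡ 4 * suc m + 2 * suc a
  regroup = solve-∀
  regroup′ : ∀ n → 4 * n + 2 * n ≡ 3 * (2 * n)
  regroup′ = solve-∀
  regroup″ : ∀ k → 3 * (k + 4) ≡ 3 * k + 8 + 4
  regroup″ = solve-∀
... | inj₂ refl = begin
  2 * m + 2 * t      ≤⟨ +-monoʳ-≤ (2 * m) (*-monoʳ-≤ 2 t≤k) ⟩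
  2 * m + 2 * k      ≤⟨ +-monoˡ-≤ (2 * k) tight ⟩
  k + 4 + 2 * k      ≡⟨ regroup k ⟩
  3 * k + 4          ∎
  where
  regroup : ∀ k → k + 4 + 2 * k ≡ 3 * k + 4
  regroup = solve-∀
  regroup′ : ∀ k a → 3 * k + a + 3 ≡ 3 * k + 2 + suc a
  regroup′ = solve-∀
  t≤k : t ≤ k
  t≤k = third≤ t k (+-cancelʳ-≤ m _ _ (begin
    3 * t + m             ≤⟨ h ⟩
    3 * k + a + 3         ≡⟨ regroup′ k a ⟩
    3 * k + 2 + suc a     ≤⟨ +-monoʳ-≤ (3 * k + 2) a<n ⟩
    3 * k + 2 + m         ∎))

C2-suc : ∀ k → suc k C 2 ≡ k + k C 2
C2-suc k = trans (sym (nCk+nC[k+1]≡[n+1]C[k+1] k 1)) (cong (_+ k C 2) (nC1≡n k))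

pred≤C2 : ∀ k → k ≤ suc k C 2
pred≤C2 k = ≤-trans (m≤m+n k (k C 2)) (≤-reflexive (sym (C2-suc k)))

-- 6n ≤ n(n-1) + 10 for n ≥ 5, i.e. (n-2)(n-5) ≥ 0.
sixBound : ∀ j → 6 * (5 + j) ≤ 2 * ((5 + j) C 2) + 10
sixBound zero = ≤-refl
sixBound (suc j) = begin
  6 * (6 + j)                              ≡⟨ regroup j ⟩
  6 + 6 * (5 + j)                          ≤⟨ +-mono-≤ six (sixBound j) ⟩
  2 * (5 + j) + (2 * ((5 + j) C 2) + 10)   ≡⟨ regroup′ (5 + j) ((5 + j) C 2) ⟩
  2 * ((5 + j) + (5 + j) C 2) + 10         ≡⟨ cong (λ c → 2 * c + 10) (C2-suc (5 + j)) ⟨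
  2 * ((6 + j) C 2) + 10                   ∎
  where
  regroup : ∀ j → 6 * (6 + j) ≡ 6 + 6 * (5 + j)
  regroup = solve-∀
  regroup′ : ∀ x c → 2 * x + (2 * c + 10) ≡ 2 * (x + c) + 10
  regroup′ = solve-∀
  six : 6 ≤ 2 * (5 + j)
  six = *-monoʳ-≤ 2 (m≤m+n 3 (2 + j))

-- For λ ≥ 2, either 6n ≤ λ·C(n,2) + 10, or λ·C(n,2) = 3k with 2n ≤ k + 4
-- (the latter for λ = 2 and n ∈ {3,4} only).
roomOrTight : ∀ l n → 2 ≤ l →
  6 * n ≤ l * (n C 2) + 10 ⊎ ∃[ k ] (l * (n C 2) ≡ 3 * k × 2 * n ≤ k + 4)
roomOrTight 0 n ()
roomOrTight 1 n (s≤s ())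
roomOrTight l 0 _ = inj₁ z≤n
roomOrTight l 1 _ = inj₁ (≤-trans (m≤m+n 6 4) (m≤n+m 10 (l * 0)))
roomOrTight l 2 2≤l = inj₁ (+-monoˡ-≤ 10 (*-monoˡ-≤ 1 2≤l))
roomOrTight 2 3 _ = inj₂ (2 , refl , ≤-refl)
roomOrTight 2 4 _ = inj₂ (4 , refl , ≤-refl)
roomOrTight (suc (suc (suc l))) 3 _ =
  inj₁ (≤-trans (m≤m+n 18 1) (+-monoˡ-≤ 10 (*-monoˡ-≤ 3 (m≤m+n 3 l))))
roomOrTight (suc (suc (suc l))) 4 _ =
  inj₁ (≤-trans (m≤m+n 24 4) (+-monoˡ-≤ 10 (*-monoˡ-≤ 6 (m≤m+n 3 l))))
roomOrTight l (suc (suc (suc (suc (suc j))))) 2≤l =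
  inj₁ (≤-trans (sixBound j) (+-monoˡ-≤ 10 (*-monoˡ-≤ ((5 + j) C 2) 2≤l)))

fewTwosBound : ∀ l n m a t → 2 ≤ l → m ≤ n → a < n →
  3 * t + m ≤ l * (n C 2) + a + 3 → 2 * m + 2 * t ≤ l * (n C 2) + 4
fewTwosBound l n m a t 2≤l m≤n a<n h with roomOrTight l n 2≤l
... | inj₁ room = roomyBound n _ m a t room m≤n a<n h
... | inj₂ (k , S≡3k , tight) rewrite S≡3k = tightBound n k m a t tight m≤n a<n h

evenSum : ∀ l n M → Even l → A2 l n M → sum M ≡ l * (n C 2)
evenSum l n M even-l a2 = a2 (∣m⇒∣m*n (n ∸ 1) even-l)

fewTwosA4 : ∀ l n M → 2 ≤ l → A1 n M → A2 l n M → ν 2 M < n → A4 l n M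
fewTwosA4 l n M 2≤l a1 a2 few even-l = begin
  2 * (maxL M + length M)    ≡⟨ *-distribˡ-+ 2 (maxL M) (length M) ⟩
  2 * maxL M + 2 * length M  ≤⟨ fewTwosBound l n (maxL M) (ν 2 M) (length M) 2≤l max≤n few countBound ⟩
  l * (n C 2) + 4            ∎
  where
  max≤n : maxL M ≤ n
  max≤n = maxL≤ M (All.map proj₂ a1)
  countBound : 3 * length M + maxL M ≤ l * (n C 2) + ν 2 M + 3
  countBound = subst (λ s → 3 * length M + maxL M ≤ s + ν 2 M + 3) (evenSum l n M even-l a2)
                 (maxEntryBound M (All.map proj₁ a1))

repeatedMaxA4 : ∀ l n M → A1 n M → A2 l n M → 2 ≤ ν (maxL M) M → A4 l n M
repeatedMaxA4 l n M a1 a2 twice even-l = begin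
  2 * (maxL M + length M)    ≡⟨ *-distribˡ-+ 2 (maxL M) (length M) ⟩
  2 * maxL M + 2 * length M  ≡⟨ +-comm (2 * maxL M) (2 * length M) ⟩
  2 * length M + 2 * maxL M  ≤⟨ copiesBound (maxL M) 2 M (All.map proj₁ a1) twice ⟩
  sum M + 4                  ≡⟨ cong (_+ 4) (evenSum l n M even-l a2) ⟩
  l * (n C 2) + 4            ∎

fewTwosA5 : ∀ l n M → 2 ≤ l → ν 2 M < n → A5 l n M
fewTwosA5 0 n M () few odd-l
fewTwosA5 1 n M (s≤s ()) few odd-l
fewTwosA5 2 n M _ few odd-l = ⊥-elim (odd-l ∣-refl)
fewTwosA5 (suc (suc (suc l))) zero M _ () odd-l
fewTwosA5 (suc (suc (suc l))) (suc k) M _ few _ = begin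
  sum2 M                  ≡⟨ sum2≡2ν₂ M ⟩
  2 * ν 2 M               ≤⟨ *-monoʳ-≤ 2 (≤-trans (s≤s⁻¹ few) (pred≤C2 k)) ⟩
  2 * (suc k C 2)         ≤⟨ *-monoˡ-≤ (suc k C 2) (m≤m+n 2 l) ⟩
  (2 + l) * (suc k C 2)   ∎

lemma2p5 : (l n : ℕ) → 2 ≤ l → 1 ≤ n → (M : List ℕ) →
    A1 n M → A2 l n M → A3 l n M →
    (ν 2 M < n ⊎ (Even l × 2 ≤ ν (maxL M) M)) →
    Admissible l n M
lemma2p5 l n 2≤l _ M a1 a2 a3 (inj₁ few) =
  a1 , a2 , a3 , fewTwosA4 l n M 2≤l a1 a2 few , fewTwosA5 l n M 2≤l few
lemma2p5 l n _ _ M a1 a2 a3 (inj₂ (even-l , twice)) =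
  a1 , a2 , a3 , repeatedMaxA4 l n M a1 a2 twice , λ odd-l → ⊥-elim (odd-l even-l)
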